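{- If $A$ is a polyomino with $n$ tiles and $h$ holes, then $p_o(A)\ge p_{\min}(n+h)=2\lceil 2\sqrt{n+h}\,\rceil$.
   Context: A polyomino is a finite union of closed unit squares (tiles) of the square lattice, any two of which intersect in nothing, a vertex, or an entire common edge, such that the interior of the union is connected. Holes are the bounded connected components of the complement. The outer perimeter $p_o(A)$ is the number of unit edges of the topological boundary of $A$ that do not bound a hole. $p_{\min}(n)=2\lceil 2\sqrt n\,\rceil$ is the minimum perimeter of a polyomino with $n$ tiles. -}

module Defs where

open import Data.Nat using (ℕ; _≤_; _*_; _⊔_)
open import Data.Integer using (ℤ; +_; _+_; _-_; ∣_∣)
open import Data.Product using (Σ; _×_; _,_; ∃)
open import Data.List using (List; []; _∷_; length)
open import Data.List.Membership.Propositional using (_∈_; _∉_)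
open import Data.List.Relation.Unary.Any using (Any)
open import Data.List.Relation.Unary.All using (All)
open import Data.List.Relation.Unary.AllPairs using (AllPairs)
open import Data.List.Relation.Unary.Unique.Propositional using (Unique)
open import Relation.Nullary using (¬_)
open import Relation.Binary.PropositionalEquality using (_≡_; _≢_)
open import Function.Bundles using (_⇔_)

-- A tile (closed unit square) is named by the lattice point of its
-- lower-left corner: (x , y) denotes [x, x+1] × [y, y+1].
Cell : Set
Cell = ℤ × ℤ

data Adj : Cell → Cell → Set where
  right : ∀ x y → Adj (x , y) (x + + 1 , y)
  left  : ∀ x y → Adj (x , y) (x - + 1 , y)
  up    : ∀ x y → Adj (x , y) (x , y + + 1)
  down  : ∀ x y → Adj (x , y) (x , y - + 1)

data Path (P : Cell → Set) : Cell → Cell → Set where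
  here : ∀ {c} → P c → Path P c c
  step : ∀ {c d e} → P c → Adj c d → Path P d e → Path P c e

norm : Cell → ℕ
norm (x , y) = ∣ x ∣ ⊔ ∣ y ∣

-- A polyomino: a nonempty finite set (duplicate-free list) of tiles whose
-- union has connected interior, i.e. any two tiles are joined by a chain of
-- tiles consecutive ones sharing an edge.
record IsPolyomino (A : List Cell) : Set where
  field
    nonempty  : A ≢ []
    distinct  : Unique A
    connected : ∀ {c d} → c ∈ A → d ∈ A → Path (λ e → e ∈ A) c d

-- Connected in the complement of A.  (The complement of the union of the
-- tiles of A decomposes into components that are exactly the edge-connected
-- classes of cells not in A.)
CompPath : List Cell → Cell → Cell → Set
CompPath A = Path (λ e → e ∉ A)

BoundedComp : List Cell → Cell → Set
BoundedComp A c = Σ ℕ λ N → ∀ d → CompPath A c d → norm d ≤ N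

InHole : List Cell → Cell → Set
InHole A c = (c ∉ A) × BoundedComp A c

-- A has exactly h holes: there are h cells, one in each hole, lying in
-- pairwise different complement components, and every hole cell is in the
-- component of one of them.
HasHoles : List Cell → ℕ → Set
HasHoles A h =
  Σ (List Cell) λ reps →
    (length reps ≡ h)
    × All (InHole A) reps
    × AllPairs (λ r s → ¬ CompPath A r s) reps
    × (∀ c → InHole A c → Any (λ r → CompPath A c r) reps)

-- A unit edge of the topological boundary of A is the common edge of a tile
-- c ∈ A and an adjacent cell d ∉ A; it is represented by the pair (c , d).
-- It bounds a hole iff d lies in a hole (i.e. in a bounded component).
OuterBoundaryEdge : List Cell → Cell × Cell → Set
OuterBoundaryEdge A (c , d) = (c ∈ A) × Adj c d × (d ∉ A) × ¬ BoundedComp A d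

OuterPerimeter : List Cell → ℕ → Set
OuterPerimeter A p =
  Σ (List (Cell × Cell)) λ L →
    Unique L × (length L ≡ p) × (∀ e → (e ∈ L) ⇔ OuterBoundaryEdge A e)

-- k = ⌈ 2 √ m ⌉, i.e. k is the least natural number with 4m ≤ k².
IsCeil2Sqrt : ℕ → ℕ → Set
IsCeil2Sqrt m k = (4 * m ≤ k * k) × (∀ j → 4 * m ≤ j * j → k ≤ j)

module Submission where

open import Defs
open import Data.Nat using (ℕ; _+_; _*_; _≤_)
open import Data.List using (List; length)
open import Relation.Binary.PropositionalEquality using (_≡_)

open import Data.Nat using (zero; suc; z≤n; s≤s)
import Data.Nat.Properties as ℕP
open import Data.Nat.GeneralisedArithmetic using (iterate)
open import Data.Nat.ListAction using (sum)
import Data.Nat.Tactic.RingSolver as ℕSolver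
open import Data.Integer as ℤ using (ℤ; ∣_∣)
import Data.Integer.Properties as ℤP
import Data.Integer.Tactic.RingSolver as ℤSolver
open import Algebra.Properties.AbelianGroup ℤP.+-0-abelianGroup using (∙-cancelˡ)
open import Data.List using ([]; _∷_; _++_; map; concat; filter; deduplicate; cartesianProduct)
open import Data.List.Properties using (length-++; length-map)
open import Data.List.Membership.Propositional using (_∈_; _∉_)
open import Data.List.Membership.Propositional.Properties
  using (∈-map⁺; ∈-map⁻; ∈-++⁺ˡ; ∈-++⁺ʳ; ∈-++⁻; ∈-∃++; ∈-filter⁺; ∈-filter⁻;
         ∈-deduplicate⁺; ∈-deduplicate⁻; ∈-cartesianProduct⁺)
open import Data.List.Membership.DecPropositional ℤ._≟_ using (_∈?_)
open import Data.List.Relation.Binary.Subset.Propositional using (_⊆_)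
open import Data.List.Relation.Binary.Disjoint.Propositional using (Disjoint)
open import Data.List.Relation.Unary.Any using (here; there)
open import Data.List.Relation.Unary.All as All using (All; []; _∷_; all?)
import Data.List.Relation.Unary.All.Properties as All
open import Data.List.Relation.Unary.AllPairs as AllPairs using (AllPairs; []; _∷_)
import Data.List.Relation.Unary.AllPairs.Properties as AllPairs
open import Data.List.Relation.Unary.Unique.Propositional using (Unique)
import Data.List.Relation.Unary.Unique.Propositional.Properties as Unique
open import Data.List.Relation.Unary.Unique.DecPropositional.Properties ℤ._≟_ using (deduplicate-!)
open import Data.List.Extrema ℤP.≤-totalOrder using (argmax; argmax-all; f[xs]≤f[argmax])
open import Data.Product using (_×_; _,_; proj₁; proj₂; ∃-syntax)
open import Data.Sum using (inj₁; inj₂)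
open import Data.Empty using (⊥-elim)
open import Function.Base using (_∘_)
open import Function.Bundles using (Equivalence)
open import Relation.Nullary using (¬_; yes; no)
open import Relation.Nullary.Decidable using (_→-dec_)
open import Relation.Unary using (Decidable)
open import Relation.Binary.PropositionalEquality using (_≢_; refl; sym; trans; cong; cong₂; subst; subst₂)
open ℕP.≤-Reasoning

-- Let w and H be the numbers of columns and of
-- rows met by A.
--  * Perimeter: in every column the highest tile of A has an upward edge
--    whose outer cell starts an upward ray avoiding A; that ray reaches
--    arbitrarily large norm, so the edge does not bound a hole.  Doing the
--    same downwards, rightwards and leftwards gives 2(w + H) distinct outer
--    boundary edges, hence p ≥ 2(w + H).
--  * Area: a hole cell lies in a column and a row met by A (otherwise a ray
--    from it escapes), so the n tiles and one cell from each of the h holes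
--    are n + h distinct cells of the w × H box: n + h ≤ wH ≤ (w + H)²/4.
-- The minimality of k = ⌈2√(n + h)⌉ then gives k ≤ w + H.

unique-⊆⇒length≤ : ∀ {a} {T : Set a} {xs ys : List T} → Unique xs → xs ⊆ ys → length xs ≤ length ys
unique-⊆⇒length≤ {xs = []} _ _ = z≤n
unique-⊆⇒length≤ {xs = x ∷ xs} (x∉xs ∷ xs!) xs⊆ys with ∈-∃++ (xs⊆ys (here refl))
... | us , vs , refl = begin
  suc (length xs)             ≤⟨ s≤s (unique-⊆⇒length≤ xs! xs⊆us++vs) ⟩
  suc (length (us ++ vs))     ≡⟨ cong suc (length-++ us) ⟩
  suc (length us + length vs) ≡⟨ ℕP.+-suc (length us) (length vs) ⟨
  length us + length (x ∷ vs) ≡⟨ length-++ us ⟨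
  length (us ++ x ∷ vs)       ∎
  where
  xs⊆us++vs : xs ⊆ us ++ vs
  xs⊆us++vs {z} z∈xs with ∈-++⁻ us (xs⊆ys (there z∈xs))
  ... | inj₁ z∈us         = ∈-++⁺ˡ z∈us
  ... | inj₂ (here refl)  = ⊥-elim (All.lookup x∉xs z∈xs refl)
  ... | inj₂ (there z∈vs) = ∈-++⁺ʳ us z∈vs

length-cartesianProduct : ∀ {a b} {S : Set a} {T : Set b} (xs : List S) (ys : List T) →
                          length (cartesianProduct xs ys) ≡ length xs * length ys
length-cartesianProduct []       ys = refl
length-cartesianProduct (x ∷ xs) ys = trans (length-++ (map (x ,_) ys))
  (cong₂ _+_ (length-map (x ,_) ys) (length-cartesianProduct xs ys))

separated⇒unique : ∀ {A rs} → All (_∉ A) rs → AllPairs (λ r s → ¬ CompPath A r s) rs → Unique rs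
separated⇒unique []            []                 = []
separated⇒unique (r∉A ∷ rs∉A) (r≁rs ∷ rs-apart) =
  All.map (λ r≁s r≡s → r≁s (subst (CompPath _ _) r≡s (here r∉A))) r≁rs ∷ separated⇒unique rs∉A rs-apart

translate-≢ : ∀ a {i j} → i ≢ j → a ℤ.+ i ≢ a ℤ.+ j
translate-≢ a i≢j eq = i≢j (∙-cancelˡ a _ _ eq)

translate-moves : ∀ a {i} → i ≢ ℤ.0ℤ → a ℤ.+ i ≢ a
translate-moves a i≢0 eq = translate-≢ a i≢0 (trans eq (sym (ℤP.+-identityʳ a)))

escape : ∀ a m → m ≤ ∣ a ℤ.+ ℤ.+ m ∣ + ∣ a ∣
escape a m = begin
  m                        ≡⟨ cong ∣_∣ (add-sub a (ℤ.+ m)) ⟨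
  ∣ a ℤ.+ ℤ.+ m ℤ.- a ∣    ≤⟨ ℤP.∣i-j∣≤∣i∣+∣j∣ (a ℤ.+ ℤ.+ m) a ⟩
  ∣ a ℤ.+ ℤ.+ m ∣ + ∣ a ∣  ∎
  where
  add-sub : ∀ a b → a ℤ.+ b ℤ.- a ≡ b
  add-sub = ℤSolver.solve-∀

strictly-deeper : ∀ i k → i ℤ.< i ℤ.+ ℤ.+ suc k
strictly-deeper i k = subst (ℤ._< i ℤ.+ ℤ.+ suc k) (ℤP.+-identityʳ i) (ℤP.+-monoʳ-< i (ℤ.+<+ (s≤s z≤n)))

-- The arithmetic–geometric mean inequality 4ab ≤ (a + b)² over ℕ: writing
-- b = a + d, (a + b)² = 4ab + d².
amgm-ordered : ∀ {a b} → a ≤ b → 4 * (a * b) ≤ (a + b) * (a + b)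
amgm-ordered {a} a≤b with ℕP.m≤n⇒∃[o]m+o≡n a≤b
... | d , refl = subst (4 * (a * (a + d)) ≤_) (sym (square a d)) (ℕP.m≤m+n _ _)
  where
  square : ∀ a d → (a + (a + d)) * (a + (a + d)) ≡ 4 * (a * (a + d)) + d * d
  square = ℕSolver.solve-∀

amgm : ∀ a b → 4 * (a * b) ≤ (a + b) * (a + b)
amgm a b with ℕP.≤-total a b
... | inj₁ a≤b = amgm-ordered a≤b
... | inj₂ b≤a = subst₂ _≤_ (cong (4 *_) (ℕP.*-comm b a)) (cong (λ s → s * s) (ℕP.+-comm b a)) (amgm-ordered b≤a)

record Direction : Set where
  field
    move       : Cell → Cell
    adjacent   : ∀ c → Adj c (move c)
    depth line : Cell → ℤ
    depth-move : ∀ c → depth (move c) ≡ depth c ℤ.+ ℤ.+ 1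
    line-move  : ∀ c → line (move c) ≡ line c
    depth≤norm : ∀ c → ∣ depth c ∣ ≤ norm c

module Rays (dir : Direction) (A : List Cell) where
  open Direction dir

  walk : ℕ → Cell → Cell
  walk k c = iterate move c k

  depth-walk : ∀ k c → depth (walk k c) ≡ depth c ℤ.+ ℤ.+ k
  depth-walk zero    c = sym (ℤP.+-identityʳ (depth c))
  depth-walk (suc k) c = trans (depth-walk k (move c))
    (trans (cong (ℤ._+ ℤ.+ k) (depth-move c)) (ℤP.+-assoc (depth c) (ℤ.+ 1) (ℤ.+ k)))

  line-walk : ∀ k c → line (walk k c) ≡ line c
  line-walk zero    c = refl
  line-walk (suc k) c = trans (line-walk k (move c)) (line-move c)

  FreeRay : Cell → Set
  FreeRay c = ∀ k → walk k c ∉ A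

  free-ray-path : ∀ {c} → FreeRay c → ∀ m → CompPath A c (walk m c)
  free-ray-path free zero        = here (free 0)
  free-ray-path {c} free (suc m) = step (free 0) (adjacent c) (free-ray-path (free ∘ suc) m)

  -- A free ray reaches cells of every depth, so it leaves any bounded region.
  free-ray-unbounded : ∀ {c} → FreeRay c → ¬ BoundedComp A c
  free-ray-unbounded {c} free (N , bounded) = ℕP.n≮n (N + ∣ depth c ∣) (begin-strict
    N + ∣ depth c ∣                     <⟨ ℕP.n<1+n _ ⟩
    m                                   ≤⟨ escape (depth c) m ⟩
    ∣ depth c ℤ.+ ℤ.+ m ∣ + ∣ depth c ∣  ≡⟨ cong (λ z → ∣ z ∣ + ∣ depth c ∣) (depth-walk m c) ⟨
    ∣ depth (walk m c) ∣ + ∣ depth c ∣   ≤⟨ ℕP.+-monoˡ-≤ _ (ℕP.≤-trans (depth≤norm _) (bounded _ (free-ray-path free m))) ⟩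
    N + ∣ depth c ∣                     ∎)
    where
    m : ℕ
    m = suc (N + ∣ depth c ∣)

  IsTop : Cell → Set
  IsTop c = All (λ c′ → line c′ ≡ line c → depth c′ ℤ.≤ depth c) A

  isTop? : Decidable IsTop
  isTop? c = all? (λ c′ → (line c′ ℤ.≟ line c) →-dec (depth c′ ℤ.≤? depth c)) A

  -- Past a top cell every cell of the ray is deeper on the same line, hence not in A.
  top-free : ∀ {c} → IsTop c → FreeRay (move c)
  top-free {c} top k c′∈A = ℤP.<⇒≱ (strictly-deeper (depth c) k)
    (subst (ℤ._≤ depth c) (depth-walk (suc k) c) (All.lookup top c′∈A (line-walk (suc k) c)))

  top-exists : ∀ {v} → v ∈ map line A → ∃[ c ] c ∈ A × line c ≡ v × IsTop c
  top-exists v∈ with ∈-map⁻ line v∈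
  ... | c₀ , c₀∈A , refl = c , proj₁ c-on-line , proj₂ c-on-line , All.tabulate deepest
    where
    on-line : List Cell
    on-line = filter (λ c′ → line c′ ℤ.≟ line c₀) A
    c : Cell
    c = argmax depth c₀ on-line
    c-on-line : c ∈ A × line c ≡ line c₀
    c-on-line = argmax-all depth (c₀∈A , refl) (All.tabulate (∈-filter⁻ _))
    deepest : ∀ {c′} → c′ ∈ A → line c′ ≡ line c → depth c′ ℤ.≤ depth c
    deepest c′∈A eq = All.lookup (f[xs]≤f[argmax] c₀ on-line) (∈-filter⁺ _ c′∈A (trans eq (proj₂ c-on-line)))

  tops : List Cell
  tops = filter isTop? A

  outerEdges : List (Cell × Cell)
  outerEdges = map (λ c → c , move c) tops

  lines : List ℤ
  lines = deduplicate ℤ._≟_ (map line A)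

  -- Distinct top cells give distinct edges, and each edge is an outer boundary
  -- edge because the ray beyond it is free.
  outerEdges-unique : Unique A → Unique outerEdges
  outerEdges-unique A! = Unique.map⁺ (cong proj₁) (Unique.filter⁺ isTop? A!)

  outerEdges-outer : All (OuterBoundaryEdge A) outerEdges
  outerEdges-outer = All.map⁺ (All.tabulate outer)
    where
    outer : ∀ {c} → c ∈ tops → OuterBoundaryEdge A (c , move c)
    outer {c} c∈tops with ∈-filter⁻ isTop? c∈tops
    ... | c∈A , top = c∈A , adjacent c , top-free top 0 , free-ray-unbounded (top-free top)

  lines≤outerEdges : length lines ≤ length outerEdges
  lines≤outerEdges = begin
    length lines           ≤⟨ unique-⊆⇒length≤ (deduplicate-! _) lines⊆ ⟩
    length (map line tops) ≡⟨ length-map line tops ⟩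
    length tops            ≡⟨ length-map _ tops ⟨
    length outerEdges      ∎
    where
    lines⊆ : lines ⊆ map line tops
    lines⊆ v∈ with top-exists (∈-deduplicate⁻ ℤ._≟_ _ v∈)
    ... | c , c∈A , refl , top = ∈-map⁺ line (∈-filter⁺ isTop? c∈A top)

  -- A hole cell lies on a line met by A, for otherwise its ray would escape.
  hole-line-met : ∀ {r} → InHole A r → line r ∈ lines
  hole-line-met {r} (_ , bounded) with line r ∈? map line A
  ... | yes met  = ∈-deduplicate⁺ ℤ._≟_ met
  ... | no unmet = ⊥-elim (free-ray-unbounded free bounded)
    where
    free : FreeRay r
    free k w∈A = unmet (subst (_∈ map line A) (line-walk k r) (∈-map⁺ line w∈A))

  tile-line-met : ∀ {c} → c ∈ A → line c ∈ lines
  tile-line-met c∈A = ∈-deduplicate⁺ ℤ._≟_ (∈-map⁺ line c∈A)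

DistinctMoves : Direction → Direction → Set
DistinctMoves d d′ = ∀ c → Direction.move d c ≢ Direction.move d′ c

-- Outer edges of distinct directions differ in their second cell.
outerEdges-disjoint : ∀ {d d′} A → DistinctMoves d d′ → Disjoint (Rays.outerEdges d A) (Rays.outerEdges d′ A)
outerEdges-disjoint {d′ = d′} A apart (e∈ , e∈′) with ∈-map⁻ _ e∈ | ∈-map⁻ _ e∈′
... | c , _ , refl | _ , _ , same =
  apart c (trans (cong proj₂ same) (cong (Direction.move d′) (sym (cong proj₁ same))))

perimeter-bound : ∀ {A p} (ds : List Direction) → Unique A → AllPairs DistinctMoves ds → OuterPerimeter A p →
                  sum (map (λ d → length (Rays.lines d A)) ds) ≤ p
perimeter-bound {A} ds A! ds-apart (L , _ , refl , L-outer) = begin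
  sum (map (λ d → length (Rays.lines d A)) ds) ≤⟨ lines≤edges ds ⟩
  length (concat (map edges ds))               ≤⟨ unique-⊆⇒length≤ edges! edges⊆L ⟩
  length L                                     ∎
  where
  edges : Direction → List (Cell × Cell)
  edges d = Rays.outerEdges d A
  edges-unique : All (Unique ∘ edges) ds
  edges-unique = All.tabulate (λ {d} _ → Rays.outerEdges-unique d A A!)
  edges-apart : AllPairs (λ d d′ → Disjoint (edges d) (edges d′)) ds
  edges-apart = AllPairs.map (λ {d} {d′} → outerEdges-disjoint {d} {d′} A) ds-apart
  edges! : Unique (concat (map edges ds))
  edges! = Unique.concat⁺ (All.map⁺ edges-unique) (AllPairs.map⁺ {f = edges} edges-apart)
  edges-outer : All (OuterBoundaryEdge A) (concat (map edges ds))
  edges-outer = All.concat⁺ (All.map⁺ (All.tabulate {xs = ds} (λ {d} _ → Rays.outerEdges-outer d A)))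
  edges⊆L : concat (map edges ds) ⊆ L
  edges⊆L e∈ = Equivalence.from (L-outer _) (All.lookup edges-outer e∈)
  lines≤edges : ∀ ds → sum (map (λ d → length (Rays.lines d A)) ds) ≤ length (concat (map edges ds))
  lines≤edges []       = z≤n
  lines≤edges (d ∷ ds) = ℕP.≤-trans (ℕP.+-mono-≤ (Rays.lines≤outerEdges d A) (lines≤edges ds))
                                    (ℕP.≤-reflexive (sym (length-++ (edges d))))

north south east west : Direction
north = record
  { move = λ (x , y) → x , y ℤ.+ ℤ.+ 1 ; adjacent = λ (x , y) → up x y
  ; depth = proj₂ ; line = proj₁ ; depth-move = λ _ → refl ; line-move = λ _ → refl
  ; depth≤norm = λ (x , y) → ℕP.m≤n⊔m ∣ x ∣ ∣ y ∣ }
south = record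
  { move = λ (x , y) → x , y ℤ.- ℤ.+ 1 ; adjacent = λ (x , y) → down x y
  ; depth = ℤ.-_ ∘ proj₂ ; line = proj₁ ; depth-move = λ (x , y) → negate-down y ; line-move = λ _ → refl
  ; depth≤norm = λ (x , y) → subst (_≤ norm (x , y)) (sym (ℤP.∣-i∣≡∣i∣ y)) (ℕP.m≤n⊔m ∣ x ∣ ∣ y ∣) }
  where
  negate-down : ∀ y → ℤ.- (y ℤ.- ℤ.+ 1) ≡ ℤ.- y ℤ.+ ℤ.+ 1
  negate-down = ℤSolver.solve-∀
east = record
  { move = λ (x , y) → x ℤ.+ ℤ.+ 1 , y ; adjacent = λ (x , y) → right x y
  ; depth = proj₁ ; line = proj₂ ; depth-move = λ _ → refl ; line-move = λ _ → refl
  ; depth≤norm = λ (x , y) → ℕP.m≤m⊔n ∣ x ∣ ∣ y ∣ }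
west = record
  { move = λ (x , y) → x ℤ.- ℤ.+ 1 , y ; adjacent = λ (x , y) → left x y
  ; depth = ℤ.-_ ∘ proj₁ ; line = proj₂ ; depth-move = λ (x , y) → negate-left x ; line-move = λ _ → refl
  ; depth≤norm = λ (x , y) → subst (_≤ norm (x , y)) (sym (ℤP.∣-i∣≡∣i∣ x)) (ℕP.m≤m⊔n ∣ x ∣ ∣ y ∣) }
  where
  negate-left : ∀ x → ℤ.- (x ℤ.- ℤ.+ 1) ≡ ℤ.- x ℤ.+ ℤ.+ 1
  negate-left = ℤSolver.solve-∀

compass : List Direction
compass = north ∷ south ∷ east ∷ west ∷ []

-- The four compass moves are pairwise different: north and south differ in
-- the row, all other pairs in the column.
compass-distinct : AllPairs DistinctMoves compass
compass-distinct =
  (north≢south ∷ (λ _ → column-apart (λ ())) ∷ (λ _ → column-apart (λ ())) ∷ []) ∷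
  ((λ _ → column-apart (λ ())) ∷ (λ _ → column-apart (λ ())) ∷ []) ∷
  (east≢west ∷ []) ∷ [] ∷ []
  where
  column-apart : ∀ {i} → i ≢ ℤ.0ℤ → ∀ {x y y′ : ℤ} → (x , y) ≢ (x ℤ.+ i , y′)
  column-apart i≢0 {x} eq = translate-moves x i≢0 (sym (cong proj₁ eq))
  north≢south : DistinctMoves north south
  north≢south (x , y) eq = translate-≢ y (λ ()) (cong proj₂ eq)
  east≢west : DistinctMoves east west
  east≢west (x , y) eq = translate-≢ x (λ ()) (cong proj₁ eq)

columns rows : List Cell → List ℤ
columns = Rays.lines north
rows    = Rays.lines east

-- The tiles together with one cell from each hole are distinct cells of the
-- box columns × rows.
area-bound : ∀ {A reps} → Unique A → All (InHole A) reps → AllPairs (λ r s → ¬ CompPath A r s) reps →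
             length A + length reps ≤ length (columns A) * length (rows A)
area-bound {A} {reps} A! holes apart = begin
  length A + length reps                         ≡⟨ length-++ A ⟨
  length (A ++ reps)                             ≤⟨ unique-⊆⇒length≤ cells! cells⊆box ⟩
  length (cartesianProduct (columns A) (rows A)) ≡⟨ length-cartesianProduct (columns A) (rows A) ⟩
  length (columns A) * length (rows A)           ∎
  where
  reps! : Unique reps
  reps! = separated⇒unique (All.map proj₁ holes) apart
  cells! : Unique (A ++ reps)
  cells! = Unique.++⁺ A! reps! (λ (c∈A , c∈reps) → proj₁ (All.lookup holes c∈reps) c∈A)
  cells⊆box : A ++ reps ⊆ cartesianProduct (columns A) (rows A)
  cells⊆box {c} c∈ with ∈-++⁻ A c∈
  ... | inj₁ c∈A    = ∈-cartesianProduct⁺ (Rays.tile-line-met north A c∈A) (Rays.tile-line-met east A c∈A)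
  ... | inj₂ c∈reps = ∈-cartesianProduct⁺ (Rays.hole-line-met north A hole) (Rays.hole-line-met east A hole)
    where
    hole : InHole A c
    hole = All.lookup holes c∈reps

mainTheorem7 : (A : List Cell) (n h p k : ℕ) → IsPolyomino A → length A ≡ n → HasHoles A h → OuterPerimeter A p → IsCeil2Sqrt (n + h) k → 2 * k ≤ p
mainTheorem7 A n h p k polyomino refl (reps , refl , holes , apart , _) perimeter (_ , least) = begin
  2 * k                    ≤⟨ ℕP.*-monoʳ-≤ 2 k≤w+H ⟩
  2 * (w + H)              ≡⟨ double w H ⟩
  w + (w + (H + (H + 0)))  ≤⟨ perimeter-bound compass distinct compass-distinct perimeter ⟩
  p                        ∎
  where
  open IsPolyomino polyomino using (distinct)
  w H : ℕ
  w = length (columns A)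
  H = length (rows A)
  double : ∀ w H → 2 * (w + H) ≡ w + (w + (H + (H + 0)))
  double = ℕSolver.solve-∀
  -- 4(n + h) ≤ 4wH ≤ (w + H)², and k is least with 4(n + h) ≤ k².
  k≤w+H : k ≤ w + H
  k≤w+H = least (w + H) (ℕP.≤-trans (ℕP.*-monoʳ-≤ 4 (area-bound distinct holes apart)) (amgm w H))
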